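{- (Past well foundedness.) Let $R_0 \in \mathcal{P}$ be a reachable RMPC process. Then there is no infinite sequence of backward transitions $R_0 \rightsquigarrow^{\ell_0} R_1 \rightsquigarrow^{\ell_1} R_2 \rightsquigarrow \cdots$, i.e., no sequence $(R_i)_{i\in\mathbb N}$ with $R_i \rightsquigarrow^{\ell_i} R_{i+1}$ for all $i \in \mathbb{N}$.
   Context: RMPC. Fix a countable set $\mathcal{A}$ of actions, rates in $\mathbb{R}_{>0}$, and a countable set $\mathcal{K}$ of keys. Forward processes: $P,Q ::= \mathbf{0} \mid \langle a,\lambda\rangle.P \mid P+Q \mid P\parallel_L Q$ ($L\subseteq\mathcal A$); reversible processes: $R,S ::= P \mid \langle a,\lambda\rangle[i].R \mid R+S \mid R\parallel_L S$ ($i\in\mathcal K$). $\mathrm{std}(R)$ means $R$ is a forward process; $\mathrm{key}(R)$ is the set of keys occurring in $R$. Every rate $\lambda$ has an associated backward rate $\overline{\lambda}>0$. Forward $\to$ and backward $\rightsquigarrow$ transition relations are the least relations closed under (symmetric variants of Cho, Par, Cho$^r$, Par$^r$ included): (Act1) if $\mathrm{std}(R)$ then $\langle a,\lambda\rangle.R \xrightarrow{\langle a,\lambda\rangle[i]} \langle a,\lambda\rangle[i].R$ for every $i\in\mathcal K$; (Act1$^r$) if $\mathrm{std}(R)$ then $\langle a,\lambda\rangle[i].R \rightsquigarrow^{\langle a,\overline\lambda\rangle[i]} \langle a,\lambda\rangle.R$. (Act2) if $R\xrightarrow{\langle b,\mu\rangle[j]}R'$ and $j\neq i$ then $\langle a,\lambda\rangle[i].R\xrightarrow{\langle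 b,\mu\rangle[j]}\langle a,\lambda\rangle[i].R'$; (Act2$^r$) the same with $\rightsquigarrow$ and label $\langle b,\overline\mu\rangle[j]$. (Cho) if $R\xrightarrow{\ell}R'$ and $\mathrm{std}(S)$ then $R+S\xrightarrow{\ell}R'+S$; (Cho$^r$) the same with $\rightsquigarrow$. (Par) if $R\xrightarrow{\langle a,\lambda\rangle[i]}R'$, $a\notin L$, $i\notin\mathrm{key}(S)$ then $R\parallel_L S\xrightarrow{\langle a,\lambda\rangle[i]}R'\parallel_L S$; (Par$^r$) the same with $\rightsquigarrow$. (Coo) if $R\xrightarrow{\langle a,\lambda\rangle[i]}R'$, $S\xrightarrow{\langle a,\mu\rangle[i]}S'$, $a\in L$ then $R\parallel_L S\xrightarrow{\langle a,\lambda\cdot\mu\rangle[i]}R'\parallel_L S'$; (Coo$^r$) if $R\rightsquigarrow^{\langle a,\overline\lambda\rangle[i]}R'$, $S\rightsquigarrow^{\langle a,\overline\mu\rangle[i]}S'$, $a\in L$ then $R\parallel_L S\rightsquigarrow^{\langle a,\overline\lambda\cdot\overline\mu\rangle[i]}R'\parallel_L S'$. $\mathcal P$ (reachable processes) = forward processes plus all processes obtained from them by finitely many forward transitions. -}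

module Defs where

open import Level using (Level)
open import Data.Product using (Σ; ∃; _,_)
open import Relation.Nullary using (¬_)
open import Relation.Binary.PropositionalEquality using (_≡_; _≢_)
open import Relation.Binary.Construct.Closure.ReflexiveTransitive using (Star)

-- A single syntax covers forward and reversible
-- processes; forward processes are those satisfying Std.
--   𝟎            : the inactive process
--   pre a r P    : ⟨a,r⟩.P
--   kpre a r i R : ⟨a,r⟩[i].R
--   R ⊕ S        : R + S
--   par R L S    : R ∥_L S   with L ⊆ A given as a predicate
data Proc (A Rate K : Set) : Set₁ where
  𝟎    : Proc A Rate K
  pre  : A → Rate → Proc A Rate K → Proc A Rate K
  kpre : A → Rate → K → Proc A Rate K → Proc A Rate K
  _⊕_  : Proc A Rate K → Proc A Rate K → Proc A Rate K
  par  : Proc A Rate K → (A → Set) → Proc A Rate K → Proc A Rate K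

record Label (A Rate K : Set) : Set where
  constructor lab
  field
    act  : A
    rate : Rate
    key  : K

module _ {A Rate K : Set} where

  data Std : Proc A Rate K → Set₁ where
    std𝟎   : Std 𝟎
    stdpre : ∀ {a r P} → Std P → Std (pre a r P)
    std⊕   : ∀ {P Q} → Std P → Std Q → Std (P ⊕ Q)
    stdpar : ∀ {P L Q} → Std P → Std Q → Std (par P L Q)

  data KeyIn (i : K) : Proc A Rate K → Set₁ where
    here  : ∀ {a r R} → KeyIn i (kpre a r i R)
    under : ∀ {a r j R} → KeyIn i R → KeyIn i (kpre a r j R)
    inpre : ∀ {a r R} → KeyIn i R → KeyIn i (pre a r R)
    in⊕ˡ  : ∀ {R S} → KeyIn i R → KeyIn i (R ⊕ S)
    in⊕ʳ  : ∀ {R S} → KeyIn i S → KeyIn i (R ⊕ S)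
    inparˡ : ∀ {R L S} → KeyIn i R → KeyIn i (par R L S)
    inparʳ : ∀ {R L S} → KeyIn i S → KeyIn i (par R L S)

  data Fwd (_·_ : Rate → Rate → Rate)
       : Proc A Rate K → Label A Rate K → Proc A Rate K → Set₁ where
    act1 : ∀ {a r R} → Std R → (i : K) →
           Fwd _·_ (pre a r R) (lab a r i) (kpre a r i R)
    act2 : ∀ {a r i b m j R R'} → Fwd _·_ R (lab b m j) R' → j ≢ i →
           Fwd _·_ (kpre a r i R) (lab b m j) (kpre a r i R')
    choˡ : ∀ {ℓ R R' S} → Fwd _·_ R ℓ R' → Std S →
           Fwd _·_ (R ⊕ S) ℓ (R' ⊕ S)
    choʳ : ∀ {ℓ R S S'} → Fwd _·_ S ℓ S' → Std R →
           Fwd _·_ (R ⊕ S) ℓ (R ⊕ S')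
    parˡ : ∀ {a r i R R' L S} → Fwd _·_ R (lab a r i) R' → ¬ L a → ¬ KeyIn i S →
           Fwd _·_ (par R L S) (lab a r i) (par R' L S)
    parʳ : ∀ {a r i R L S S'} → Fwd _·_ S (lab a r i) S' → ¬ L a → ¬ KeyIn i R →
           Fwd _·_ (par R L S) (lab a r i) (par R L S')
    coo  : ∀ {a r m i R R' L S S'} → Fwd _·_ R (lab a r i) R' →
           Fwd _·_ S (lab a m i) S' → L a →
           Fwd _·_ (par R L S) (lab a (r · m) i) (par R' L S')

  -- backward transition relation  R ~~ℓ~~> R'  (bar gives the backward rate)
  data Bwd (_·_ : Rate → Rate → Rate) (bar : Rate → Rate)
       : Proc A Rate K → Label A Rate K → Proc A Rate K → Set₁ where
    act1r : ∀ {a r i R} → Std R →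
            Bwd _·_ bar (kpre a r i R) (lab a (bar r) i) (pre a r R)
    act2r : ∀ {a r i b m j R R'} → Bwd _·_ bar R (lab b (bar m) j) R' → j ≢ i →
            Bwd _·_ bar (kpre a r i R) (lab b (bar m) j) (kpre a r i R')
    choˡr : ∀ {ℓ R R' S} → Bwd _·_ bar R ℓ R' → Std S →
            Bwd _·_ bar (R ⊕ S) ℓ (R' ⊕ S)
    choʳr : ∀ {ℓ R S S'} → Bwd _·_ bar S ℓ S' → Std R →
            Bwd _·_ bar (R ⊕ S) ℓ (R ⊕ S')
    parˡr : ∀ {a r i R R' L S} → Bwd _·_ bar R (lab a r i) R' → ¬ L a → ¬ KeyIn i S →
            Bwd _·_ bar (par R L S) (lab a r i) (par R' L S)
    parʳr : ∀ {a r i R L S S'} → Bwd _·_ bar S (lab a r i) S' → ¬ L a → ¬ KeyIn i R →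
            Bwd _·_ bar (par R L S) (lab a r i) (par R L S')
    coor  : ∀ {a r m i R R' L S S'} → Bwd _·_ bar R (lab a (bar r) i) R' →
            Bwd _·_ bar S (lab a (bar m) i) S' → L a →
            Bwd _·_ bar (par R L S) (lab a (bar r · bar m) i) (par R' L S')

  FStep : (Rate → Rate → Rate) → Proc A Rate K → Proc A Rate K → Set₁
  FStep _·_ R R' = ∃ λ ℓ → Fwd _·_ R ℓ R'

  Reachable : (Rate → Rate → Rate) → Proc A Rate K → Set₁
  Reachable _·_ R = Σ (Proc A Rate K) λ P → Σ (Std P) λ _ → Star (FStep _·_) P R

-- Every backward step removes exactly one keyed prefix from each side of a
-- synchronisation, so the number of keyed prefixes strictly decreases.

module Submission where

open import Defs
open import Data.Nat using (ℕ; zero; suc; _+_; _<_; s≤s)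
open import Data.Nat.Properties using (≤-refl; +-monoˡ-<; +-monoʳ-<; +-mono-<)
open import Data.Nat.Induction using (<-wellFounded)
open import Data.Product using (Σ; _×_; _,_)
open import Induction.WellFounded using (WellFounded; Acc; acc)
open import Induction.InfiniteDescent using (InfiniteDescendingSequence)
open import Relation.Binary.Core using (Rel)
open import Relation.Binary.Construct.On as On using ()
open import Relation.Nullary using (¬_)
open import Relation.Binary.PropositionalEquality using (_≡_)

acc⇒¬infiniteDescendingSequence : ∀ {a r} {X : Set a} {_<_ : Rel X r} (f : ℕ → X) →
  Acc _<_ (f zero) → ¬ InfiniteDescendingSequence _<_ f
acc⇒¬infiniteDescendingSequence f (acc rs) descends =
  acc⇒¬infiniteDescendingSequence (λ n → f (suc n)) (rs (descends zero)) (λ n → descends (suc n))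

wf⇒¬infiniteDescendingSequence : ∀ {a r} {X : Set a} {_<_ : Rel X r} →
  WellFounded _<_ → (f : ℕ → X) → ¬ InfiniteDescendingSequence _<_ f
wf⇒¬infiniteDescendingSequence wf f = acc⇒¬infiniteDescendingSequence f (wf (f zero))

module _ {A Rate K : Set} where

  keyedPrefixCount : Proc A Rate K → ℕ
  keyedPrefixCount 𝟎              = 0
  keyedPrefixCount (pre _ _ P)    = keyedPrefixCount P
  keyedPrefixCount (kpre _ _ _ P) = suc (keyedPrefixCount P)
  keyedPrefixCount (P ⊕ Q)        = keyedPrefixCount P + keyedPrefixCount Q
  keyedPrefixCount (par P _ Q)    = keyedPrefixCount P + keyedPrefixCount Q

  Bwd⇒keyedPrefixCount-< : ∀ {_·_ bar R ℓ R'} → Bwd _·_ bar R ℓ R' →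
                           keyedPrefixCount R' < keyedPrefixCount R
  Bwd⇒keyedPrefixCount-< (act1r _)       = ≤-refl
  Bwd⇒keyedPrefixCount-< (act2r b _)     = s≤s (Bwd⇒keyedPrefixCount-< b)
  Bwd⇒keyedPrefixCount-< (choˡr b _)     = +-monoˡ-< _ (Bwd⇒keyedPrefixCount-< b)
  Bwd⇒keyedPrefixCount-< (choʳr {R = R} b _) =
    +-monoʳ-< (keyedPrefixCount R) (Bwd⇒keyedPrefixCount-< b)
  Bwd⇒keyedPrefixCount-< (parˡr b _ _)   = +-monoˡ-< _ (Bwd⇒keyedPrefixCount-< b)
  Bwd⇒keyedPrefixCount-< (parʳr {R = R} b _ _) =
    +-monoʳ-< (keyedPrefixCount R) (Bwd⇒keyedPrefixCount-< b)
  Bwd⇒keyedPrefixCount-< (coor b c _)    =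
    +-mono-< (Bwd⇒keyedPrefixCount-< b) (Bwd⇒keyedPrefixCount-< c)

  keyedPrefixCount-<-wellFounded :
    WellFounded (λ (R' R : Proc A Rate K) → keyedPrefixCount R' < keyedPrefixCount R)
  keyedPrefixCount-<-wellFounded = On.wellFounded keyedPrefixCount <-wellFounded

lemma4p7 : {A Rate K : Set} (_·_ : Rate → Rate → Rate) (bar : Rate → Rate)
    (R₀ : Proc A Rate K) → Reachable _·_ R₀ →
    ¬ (Σ (ℕ → Proc A Rate K) λ R → Σ (ℕ → Label A Rate K) λ ℓ →
         (R zero ≡ R₀) × ((n : ℕ) → Bwd _·_ bar (R n) (ℓ n) (R (suc n))))
lemma4p7 _ _ _ _ (R , _ , _ , steps) =
  wf⇒¬infiniteDescendingSequence keyedPrefixCount-<-wellFounded R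
    (λ n → Bwd⇒keyedPrefixCount-< (steps n))
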